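{- Let $C$ be a non-trivial (i.e. $|C|\geq 2$) neighbour-transitive code in $K(2k+1,k)=O_{k+1}$ with minimum distance $\delta=1$, and suppose that $\mathrm{Aut}(C)$ acts transitively but imprimitively on $\Omega$ with system of imprimitivity $\{B_1,\ldots,B_a\}$, where $|B_i|=b$ for each $i$ and $ab=2k+1$ with $a,b\geq 2$. For each $\alpha\subseteq\Omega$ let $\iota(\alpha)$ be the multiset $\{|\alpha\cap B_i|\mid i=1,\ldots,a\}$. Then one of the following holds: (1) $\iota(\alpha)=\{(\tfrac{b-1}{2})^{(a+1)/2},(\tfrac{b+1}{2})^{(a-1)/2}\}$ for all $\alpha\in C$; (2) $\iota(\alpha)=\{0^{(a-1)/2},\tfrac{b-1}{2},b^{(a-1)/2}\}$ for all $\alpha\in C$.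
   Context: Let $k\geq 2$. The odd graph $O_{k+1}=K(2k+1,k)$ has as vertices the $k$-subsets of a $(2k+1)$-set $\Omega$, adjacent iff disjoint; its automorphism group is $\mathrm{Sym}(\Omega)$. For a code $C$ (set of vertices), with $d$ graph distance, the minimum distance $\delta$ is the least distance between distinct codewords; $C_1$ is the set of vertices not in $C$ but adjacent to some codeword; $\mathrm{Aut}(C)$ is the setwise stabiliser of $C$ in $\mathrm{Sym}(\Omega)$; $C$ is neighbour-transitive if $C_1\ne\emptyset$ and $\mathrm{Aut}(C)$ is transitive on $C$ and on $C_1$. Multiset notation: $\{c_1^{m_1},\ldots,c_s^{m_s}\}$ denotes the multiset containing $c_j$ with multiplicity $m_j$ (no exponent means multiplicity $1$). -}

module Defs where

open import Data.Nat using (ℕ; suc; _*_; _+_; _∸_; _/_)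
open import Data.Fin using (Fin; _≟_)
open import Data.Fin.Subset using (Subset; _∩_; ⊥; ∣_∣)
open import Data.Fin.Permutation using (Permutation′; _⟨$⟩ʳ_; _⟨$⟩ˡ_)
open import Data.Vec using (tabulate; lookup)
open import Data.List using (List; map; allFin; replicate; _++_; [_])
open import Data.Product using (Σ; ∃; _×_; _,_)
open import Relation.Nullary using (¬_; Dec)
open import Relation.Nullary.Decidable using (⌊_⌋)
open import Relation.Binary.PropositionalEquality using (_≡_; _≢_)
open import Function.Bundles using (_⇔_)

Ω : ℕ → Set
Ω k = Fin (suc (2 * k))

Sub : ℕ → Set
Sub k = Subset (suc (2 * k))

IsVertex : (k : ℕ) → Sub k → Set
IsVertex k α = ∣ α ∣ ≡ k

Adjacent : (k : ℕ) → Sub k → Sub k → Set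
Adjacent k α β = α ∩ β ≡ ⊥

-- A code: a set of vertices (given as a predicate on subsets; membership
-- implies being a k-subset is imposed as a hypothesis).
Code : ℕ → Set₁
Code k = Sub k → Set

IsCodeIn : (k : ℕ) → Code k → Set
IsCodeIn k C = ∀ α → C α → IsVertex k α

Sym : ℕ → Set
Sym k = Permutation′ (suc (2 * k))

act : (k : ℕ) → Sym k → Sub k → Sub k
act k g α = tabulate (λ y → lookup α (g ⟨$⟩ˡ y))

InAut : (k : ℕ) → Code k → Sym k → Set
InAut k C g = ∀ α → C α ⇔ C (act k g α)

InC₁ : (k : ℕ) → Code k → Sub k → Set
InC₁ k C α = IsVertex k α × ¬ C α × ∃ λ (β : Sub k) → C β × Adjacent k α β

NeighbourTransitive : (k : ℕ) → Code k → Set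
NeighbourTransitive k C =
  (∃ λ (α : Sub k) → InC₁ k C α)
  × (∀ α β → C α → C β → ∃ λ (g : Sym k) → InAut k C g × act k g α ≡ β)
  × (∀ α β → InC₁ k C α → InC₁ k C β → ∃ λ (g : Sym k) → InAut k C g × act k g α ≡ β)

NonTrivial : (k : ℕ) → Code k → Set
NonTrivial k C = ∃ λ (α : Sub k) → ∃ λ (β : Sub k) → C α × C β × α ≢ β

-- Minimum distance δ = 1. Distinct vertices are at graph distance ≥ 1 and
-- distance exactly 1 means adjacent, so δ = 1 iff two codewords are adjacent
-- (adjacent vertices are automatically distinct).
MinDistOne : (k : ℕ) → Code k → Set
MinDistOne k C = ∃ λ (α : Sub k) → ∃ λ (β : Sub k) → C α × C β × Adjacent k α β

TransitiveOnΩ : (k : ℕ) → Code k → Set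
TransitiveOnΩ k C = ∀ (x y : Ω k) → ∃ λ (g : Sym k) → InAut k C g × g ⟨$⟩ʳ x ≡ y

Block : (k a : ℕ) → (Ω k → Fin a) → Fin a → Sub k
Block k a blk i = tabulate (λ x → ⌊ blk x ≟ i ⌋)

IsBlockSystem : (k : ℕ) → Code k → (a b : ℕ) → (Ω k → Fin a) → Set
IsBlockSystem k C a b blk =
  (∀ i → ∣ Block k a blk i ∣ ≡ b)
  × (∀ (g : Sym k) → InAut k C g → ∀ x y → blk x ≡ blk y → blk (g ⟨$⟩ʳ x) ≡ blk (g ⟨$⟩ʳ y))

-- ι(α): the multiset { |α ∩ B_i| : i = 1..a }, as a list (compared up to
-- permutation, i.e. as a multiset).
ι : (k a : ℕ) → (Ω k → Fin a) → Sub k → List ℕ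
ι k a blk α = map (λ i → ∣ α ∩ Block k a blk i ∣) (allFin a)

multiset₁ : ℕ → ℕ → List ℕ
multiset₁ a b = replicate ((a + 1) / 2) ((b ∸ 1) / 2) ++ replicate ((a ∸ 1) / 2) ((b + 1) / 2)

multiset₂ : ℕ → ℕ → List ℕ
multiset₂ a b = replicate ((a ∸ 1) / 2) 0 ++ [ (b ∸ 1) / 2 ] ++ replicate ((a ∸ 1) / 2) b

{-# OPTIONS --safe #-}
module Submission where

-- Let α be a codeword, c i = ∣ α ∩ B i ∣, b = 2h + 1 and a = 2q + 1. Aut(C) permutes the
-- blocks, so all codewords share the multiset of values of c, and all vertices of C₁ share
-- one multiset as well. The neighbours of α are the sets γ = Ω ∖ (α ∪ {y}) with y ∉ α, and
-- ∣ γ ∩ B i ∣ = b − c i − [y ∈ B i]. A neighbour in C (one exists since δ = 1) forces the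
-- block of y to meet α in h points, and then the multiplicities m of the values of c satisfy
-- m t + [h = s] = m s + [h = t] whenever t + s = b. Every other neighbour lies in C₁, and
-- neighbours with the same multiset come from blocks meeting α equally, so all values of c
-- other than h and b coincide. Counting gives h^(q+1) (h+1)^q if h + 1 occurs, and
-- 0^q h b^q otherwise.

open import Defs
open import Data.Bool using (Bool; true; false; _∧_; not)
open import Data.Bool.Properties using (∧-identityʳ; ∧-zeroʳ)
open import Data.Empty using (⊥; ⊥-elim)
open import Data.Fin using (Fin; zero; suc; _≟_; punchIn)
open import Data.Fin.Properties using (punchInᵢ≢i)
open import Data.Fin.Permutation using (Permutation; _⟨$⟩ʳ_; _⟨$⟩ˡ_; flip; permutation; inverseˡ; inverseʳ)
open import Data.Fin.Subset using (Subset; _∩_; ∣_∣; ⊤) renaming (⊥ to ∅)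
open import Data.Fin.Subset.Properties using (∩-identityʳ; ∩-comm; ∣⊤∣≡n; ∣p∩q∣≤∣q∣)
open import Data.List using (List; []; _∷_; _++_; tabulate; replicate; [_])
open import Data.List.Properties using (map-tabulate)
open import Data.List.Relation.Binary.Permutation.Propositional using (_↭_; ↭-refl; ↭-trans; ↭-sym; prep)
open import Data.List.Relation.Binary.Permutation.Propositional.Properties using (shift)
import Data.Nat as ℕ
open import Data.Nat using (ℕ; zero; suc; _+_; _*_; _∸_; _≤_; _<_; _≥_; z≤n; s≤s; z<s)
open import Data.Nat.DivMod using (_/_; m*n/n≡m)
open import Data.Nat.Properties hiding (_≟_)
open import Algebra.Properties.CommutativeMonoid.Sum +-0-commutativeMonoid
  using (sum; sum-cong-≗; ∑-distrib-+; sum-permute; sum-remove; sum-replicate-zero)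
open import Data.Product using (∃; _×_; _,_; proj₁; proj₂)
import Data.Sum
open import Data.Sum using (_⊎_; inj₁; inj₂; [_,_]′)
open import Data.Vec using (lookup)
import Data.Vec as Vec
open import Data.Vec.Functional using (removeAt)
open import Data.Vec.Properties using (lookup-zipWith; lookup∘tabulate; lookup-replicate; tabulate∘lookup; tabulate-cong)
open import Function.Bundles using (mk⇔; Equivalence)
open import Relation.Binary.PropositionalEquality hiding ([_])
open import Relation.Nullary using (Dec; yes; no; ¬_)
open import Relation.Nullary.Decidable using (⌊_⌋; decidable-stable)

𝟙 : Bool → ℕ
𝟙 true = 1
𝟙 false = 0

𝟙-yes : ∀ {ℓ} {P : Set ℓ} (d : Dec P) → P → 𝟙 ⌊ d ⌋ ≡ 1
𝟙-yes (yes _) _ = refl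
𝟙-yes (no ¬p) p = ⊥-elim (¬p p)

𝟙-no : ∀ {ℓ} {P : Set ℓ} (d : Dec P) → ¬ P → 𝟙 ⌊ d ⌋ ≡ 0
𝟙-no (yes p) ¬p = ⊥-elim (¬p p)
𝟙-no (no _) _ = refl

𝟙-pos : ∀ {ℓ} {P : Set ℓ} (d : Dec P) → 0 < 𝟙 ⌊ d ⌋ → P
𝟙-pos (yes p) _ = p

⌊⌋-cong : ∀ {ℓ ℓ′} {P : Set ℓ} {Q : Set ℓ′} (d : Dec P) (e : Dec Q) →
          (P → Q) → (Q → P) → ⌊ d ⌋ ≡ ⌊ e ⌋
⌊⌋-cong (yes p) (yes q) f g = refl
⌊⌋-cong (yes p) (no ¬q) f g = ⊥-elim (¬q (f p))
⌊⌋-cong (no ¬p) (yes q) f g = ⊥-elim (¬p (g q))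
⌊⌋-cong (no ¬p) (no ¬q) f g = refl

𝟙≤1 : ∀ u → 𝟙 u ≤ 1
𝟙≤1 true = ≤-refl
𝟙≤1 false = z≤n

sum-ones : ∀ n → sum {n} (λ _ → 1) ≡ n
sum-ones zero = refl
sum-ones (suc n) = cong suc (sum-ones n)

sum-mono-≤ : ∀ {n} {f g : Fin n → ℕ} → (∀ i → f i ≤ g i) → sum f ≤ sum g
sum-mono-≤ {zero} f≤g = z≤n
sum-mono-≤ {suc n} f≤g = +-mono-≤ (f≤g zero) (sum-mono-≤ (λ i → f≤g (suc i)))

sum-<⇒∃< : ∀ {n} {f g : Fin n → ℕ} → sum f < sum g → ∃ λ i → f i < g i
sum-<⇒∃< {zero} ()
sum-<⇒∃< {suc n} {f} {g} Σf<Σg with f zero <? g zero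
... | yes f₀<g₀ = zero , f₀<g₀
... | no f₀≮g₀ =
  let i , fᵢ<gᵢ = sum-<⇒∃< (+-cancelˡ-< (g zero) _ _ (≤-<-trans (+-monoˡ-≤ _ (≮⇒≥ f₀≮g₀)) Σf<Σg))
  in suc i , fᵢ<gᵢ

pointwise-≤-sum-≡⇒≡ : ∀ {n} {f g : Fin n → ℕ} → (∀ i → f i ≤ g i) → sum f ≡ sum g → ∀ i → f i ≡ g i
pointwise-≤-sum-≡⇒≡ f≤g Σf≡Σg i with m≤n⇒m<n∨m≡n (f≤g i)
... | inj₂ fᵢ≡gᵢ = fᵢ≡gᵢ
... | inj₁ fᵢ<gᵢ = ⊥-elim (<⇒≢ (sum-< f≤g i fᵢ<gᵢ) Σf≡Σg)
  where
  sum-< : ∀ {n} {f g : Fin n → ℕ} → (∀ i → f i ≤ g i) → ∀ i → f i < g i → sum f < sum g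
  sum-< f≤g zero f₀<g₀ = +-mono-<-≤ f₀<g₀ (sum-mono-≤ (λ i → f≤g (suc i)))
  sum-< f≤g (suc i) fᵢ<gᵢ = +-mono-≤-< (f≤g zero) (sum-< (λ i → f≤g (suc i)) i fᵢ<gᵢ)

sum-agree-off : ∀ {n} (j : Fin n) {f g : Fin n → ℕ} → (∀ i → i ≢ j → f i ≡ g i) → sum f + g j ≡ sum g + f j
sum-agree-off {suc n} j {f} {g} f≗g-off = begin
  sum f + g j                             ≡⟨ cong (_+ g j) (sum-remove {i = j} f) ⟩
  f j + sum (removeAt f j) + g j          ≡⟨ cong (λ s → f j + s + g j) (sum-cong-≗ removed) ⟩
  f j + sum (removeAt g j) + g j          ≡⟨ swap (f j) (sum (removeAt g j)) (g j) ⟩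
  g j + sum (removeAt g j) + f j          ≡⟨ cong (_+ f j) (sum-remove {i = j} g) ⟨
  sum g + f j                             ∎
  where
  open ≡-Reasoning
  removed : ∀ i → f (punchIn j i) ≡ g (punchIn j i)
  removed i = f≗g-off (punchIn j i) (punchInᵢ≢i j i)
  swap : ∀ x s y → x + s + y ≡ y + s + x
  swap x s y = trans (+-comm (x + s) y) (trans (cong (y +_) (+-comm x s)) (sym (+-assoc y s x)))

sum-concentrated : ∀ {n} (j : Fin n) {f : Fin n → ℕ} → (∀ i → i ≢ j → f i ≡ 0) → sum f ≡ f j
sum-concentrated {n} j {f} f-off = begin
  sum f                   ≡⟨ +-identityʳ (sum f) ⟨
  sum f + 0               ≡⟨ sum-agree-off j f-off ⟩
  sum {n} (λ _ → 0) + f j ≡⟨ cong (_+ f j) (sum-replicate-zero n) ⟩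
  f j                     ∎
  where open ≡-Reasoning

≤-sum : ∀ {n} (f : Fin n → ℕ) i → f i ≤ sum f
≤-sum f zero = m≤m+n _ _
≤-sum f (suc i) = ≤-trans (≤-sum (λ j → f (suc j)) i) (m≤n+m _ (f zero))

-- Multiplicities of values

mult : ∀ {n} → ℕ → (Fin n → ℕ) → ℕ
mult t f = sum (λ i → 𝟙 ⌊ f i ℕ.≟ t ⌋)

mult-pos⇒∃ : ∀ {n} {t} (f : Fin n → ℕ) → 0 < mult t f → ∃ λ i → f i ≡ t
mult-pos⇒∃ {n} {t} f 0<mult =
  let i , 0<𝟙 = sum-<⇒∃< {f = λ _ → 0} (subst (_< mult t f) (sym (sum-replicate-zero n)) 0<mult)
  in i , 𝟙-pos (f i ℕ.≟ t) 0<𝟙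

∃⇒mult-pos : ∀ {n} {t} (f : Fin n → ℕ) i → f i ≡ t → 0 < mult t f
∃⇒mult-pos {t = t} f i fᵢ≡t =
  ≤-trans (≤-reflexive (sym (𝟙-yes (f i ℕ.≟ t) fᵢ≡t))) (≤-sum (λ j → 𝟙 ⌊ f j ℕ.≟ t ⌋) i)

mult-absent : ∀ {n} {t} (f : Fin n → ℕ) → (∀ i → f i ≢ t) → mult t f ≡ 0
mult-absent {n} {t} f f≢t = trans (sum-cong-≗ (λ i → 𝟙-no (f i ℕ.≟ t) (f≢t i))) (sum-replicate-zero n)

mult-three-values : ∀ {n} {x y z} (f : Fin n → ℕ) → x ≢ y → x ≢ z → y ≢ z →
                    (∀ i → f i ≡ x ⊎ f i ≡ y ⊎ f i ≡ z) → mult x f + mult y f + mult z f ≡ n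
mult-three-values {n} {x} {y} {z} f x≢y x≢z y≢z f∈xyz = begin
  mult x f + mult y f + mult z f ≡⟨ cong (_+ mult z f) (∑-distrib-+ [x] [y]) ⟨
  sum (λ i → [x] i + [y] i) + mult z f ≡⟨ ∑-distrib-+ (λ i → [x] i + [y] i) [z] ⟨
  sum (λ i → [x] i + [y] i + [z] i) ≡⟨ sum-cong-≗ one ⟩
  sum {n} (λ _ → 1) ≡⟨ sum-ones n ⟩
  n ∎
  where
  open ≡-Reasoning
  [x] [y] [z] : Fin n → ℕ
  [x] i = 𝟙 ⌊ f i ℕ.≟ x ⌋
  [y] i = 𝟙 ⌊ f i ℕ.≟ y ⌋
  [z] i = 𝟙 ⌊ f i ℕ.≟ z ⌋
  one : ∀ i → [x] i + [y] i + [z] i ≡ 1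
  one i with f∈xyz i
  ... | inj₁ refl =
    cong₂ _+_ (cong₂ _+_ (𝟙-yes (f i ℕ.≟ x) refl) (𝟙-no (f i ℕ.≟ y) x≢y)) (𝟙-no (f i ℕ.≟ z) x≢z)
  ... | inj₂ (inj₁ refl) =
    cong₂ _+_ (cong₂ _+_ (𝟙-no (f i ℕ.≟ x) (≢-sym x≢y)) (𝟙-yes (f i ℕ.≟ y) refl)) (𝟙-no (f i ℕ.≟ z) y≢z)
  ... | inj₂ (inj₂ refl) =
    cong₂ _+_ (cong₂ _+_ (𝟙-no (f i ℕ.≟ x) (≢-sym x≢z)) (𝟙-no (f i ℕ.≟ y) (≢-sym y≢z))) (𝟙-yes (f i ℕ.≟ z) refl)

count : ℕ → List ℕ → ℕ
count t [] = 0
count t (x ∷ xs) = 𝟙 ⌊ x ℕ.≟ t ⌋ + count t xs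

count-tabulate : ∀ {n} t (f : Fin n → ℕ) → count t (tabulate f) ≡ mult t f
count-tabulate {zero} t f = refl
count-tabulate {suc n} t f = cong (𝟙 ⌊ f zero ℕ.≟ t ⌋ +_) (count-tabulate t (λ i → f (suc i)))

count-++ : ∀ t xs ys → count t (xs ++ ys) ≡ count t xs + count t ys
count-++ t [] ys = refl
count-++ t (x ∷ xs) ys =
  trans (cong (𝟙 ⌊ x ℕ.≟ t ⌋ +_) (count-++ t xs ys)) (sym (+-assoc (𝟙 ⌊ x ℕ.≟ t ⌋) (count t xs) _))

count-replicate-≡ : ∀ n x → count x (replicate n x) ≡ n
count-replicate-≡ zero x = refl
count-replicate-≡ (suc n) x = cong₂ _+_ (𝟙-yes (x ℕ.≟ x) refl) (count-replicate-≡ n x)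

count-replicate-≢ : ∀ n {x t} → x ≢ t → count t (replicate n x) ≡ 0
count-replicate-≢ zero x≢t = refl
count-replicate-≢ (suc n) {x} {t} x≢t = cong₂ _+_ (𝟙-no (x ℕ.≟ t) x≢t) (count-replicate-≢ n x≢t)

count-pos⇒split : ∀ x ys → 0 < count x ys → ∃ λ ys₁ → ∃ λ ys₂ → ys ≡ ys₁ ++ x ∷ ys₂
count-pos⇒split x (y ∷ ys) 0<count with y ℕ.≟ x
... | yes refl = [] , ys , refl
... | no _ = let ys₁ , ys₂ , ys≡ = count-pos⇒split x ys 0<count in y ∷ ys₁ , ys₂ , cong (y ∷_) ys≡

count-≗⇒↭ : ∀ xs ys → (∀ t → count t xs ≡ count t ys) → xs ↭ ys
count-≗⇒↭ [] [] _ = ↭-refl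
count-≗⇒↭ [] (y ∷ ys) counts = ⊥-elim (1+n≢0 (sym (trans (counts y) (cong (_+ count y ys) (𝟙-yes (y ℕ.≟ y) refl)))))
count-≗⇒↭ (x ∷ xs) ys counts
  with count-pos⇒split x ys (subst (0 <_) (counts x) (subst (λ z → 0 < z + count x xs) (sym (𝟙-yes (x ℕ.≟ x) refl)) z<s))
... | ys₁ , ys₂ , refl = ↭-trans (prep x (count-≗⇒↭ xs (ys₁ ++ ys₂) counts′)) (↭-sym (shift x ys₁ ys₂))
  where
  counts′ : ∀ t → count t xs ≡ count t (ys₁ ++ ys₂)
  counts′ t = +-cancelˡ-≡ [x] _ _ (begin
    [x] + count t xs                          ≡⟨ counts t ⟩
    count t (ys₁ ++ x ∷ ys₂)                  ≡⟨ count-++ t ys₁ (x ∷ ys₂) ⟩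
    count t ys₁ + ([x] + count t ys₂)         ≡⟨ +-assoc (count t ys₁) [x] _ ⟨
    count t ys₁ + [x] + count t ys₂           ≡⟨ cong (_+ count t ys₂) (+-comm (count t ys₁) [x]) ⟩
    [x] + count t ys₁ + count t ys₂           ≡⟨ +-assoc [x] (count t ys₁) _ ⟩
    [x] + (count t ys₁ + count t ys₂)         ≡⟨ cong ([x] +_) (count-++ t ys₁ ys₂) ⟨
    [x] + count t (ys₁ ++ ys₂)                ∎)
    where
    open ≡-Reasoning
    [x] = 𝟙 ⌊ x ℕ.≟ t ⌋

tabulate-↭-three-values : ∀ {n} {x y z} (f : Fin n → ℕ) → x ≢ y → x ≢ z → y ≢ z →
                          (∀ i → f i ≡ x ⊎ f i ≡ y ⊎ f i ≡ z) →
                          tabulate f ↭ replicate (mult x f) x ++ replicate (mult y f) y ++ replicate (mult z f) z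
tabulate-↭-three-values {x = x} {y} {z} f x≢y x≢z y≢z f∈xyz = count-≗⇒↭ _ _ (λ t → begin
  count t (tabulate f)                    ≡⟨ count-tabulate t f ⟩
  mult t f                                ≡⟨ mult≡counts t ⟩
  count t Rx + (count t Ry + count t Rz)  ≡⟨ cong (count t Rx +_) (count-++ t Ry Rz) ⟨
  count t Rx + count t (Ry ++ Rz)         ≡⟨ count-++ t Rx (Ry ++ Rz) ⟨
  count t (Rx ++ Ry ++ Rz)                ∎)
  where
  open ≡-Reasoning
  Rx = replicate (mult x f) x
  Ry = replicate (mult y f) y
  Rz = replicate (mult z f) z
  mult≡counts : ∀ t → mult t f ≡ count t Rx + (count t Ry + count t Rz)
  mult≡counts t with t ℕ.≟ x | t ℕ.≟ y | t ℕ.≟ z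
  ... | yes refl | _ | _ = sym (trans (cong₂ _+_ (count-replicate-≡ (mult x f) x)
          (cong₂ _+_ (count-replicate-≢ (mult y f) (≢-sym x≢y)) (count-replicate-≢ (mult z f) (≢-sym x≢z))))
          (+-identityʳ _))
  ... | no t≢x | yes refl | _ = sym (cong₂ _+_ (count-replicate-≢ (mult x f) (≢-sym t≢x))
          (trans (cong₂ _+_ (count-replicate-≡ (mult y f) y) (count-replicate-≢ (mult z f) (≢-sym y≢z))) (+-identityʳ _)))
  ... | no t≢x | no t≢y | yes refl = sym (cong₂ _+_ (count-replicate-≢ (mult x f) (≢-sym t≢x))
          (cong₂ _+_ (count-replicate-≢ (mult y f) (≢-sym t≢y)) (count-replicate-≡ (mult z f) z)))
  ... | no t≢x | no t≢y | no t≢z = trans (mult-absent f absent) (sym (cong₂ _+_ (count-replicate-≢ (mult x f) (≢-sym t≢x))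
          (cong₂ _+_ (count-replicate-≢ (mult y f) (≢-sym t≢y)) (count-replicate-≢ (mult z f) (≢-sym t≢z)))))
    where
    absent : ∀ i → f i ≢ t
    absent i fᵢ≡t with f∈xyz i
    ... | inj₁ fᵢ≡x = t≢x (trans (sym fᵢ≡t) fᵢ≡x)
    ... | inj₂ (inj₁ fᵢ≡y) = t≢y (trans (sym fᵢ≡t) fᵢ≡y)
    ... | inj₂ (inj₂ fᵢ≡z) = t≢z (trans (sym fᵢ≡t) fᵢ≡z)

-- Complementary block profiles

odd-half-unique : ∀ x y → x + x + 1 ≡ suc (2 * y) → x ≡ y
odd-half-unique x y x+x+1≡1+2y = *-cancelˡ-≡ x y 2
  (trans (cong (x +_) (+-identityʳ x)) (suc-injective (trans (+-comm 1 (x + x)) x+x+1≡1+2y)))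

-- Complement b c j e: e is the profile of Ω ∖ (α ∪ {y}) when α has profile c and y lies in block j.
Complement : ∀ {a} → ℕ → (Fin a → ℕ) → Fin a → (Fin a → ℕ) → Set
Complement b c j e = ∀ i → e i + c i + 𝟙 ⌊ j ≟ i ⌋ ≡ b

module _ {a b : ℕ} {c : Fin a → ℕ} where

  complement-at : ∀ {j e} → Complement b c j e → e j + c j + 1 ≡ b
  complement-at {j} {e} comp = trans (cong (e j + c j +_) (sym (𝟙-yes (j ≟ j) refl))) (comp j)

  complement-off : ∀ {j e} → Complement b c j e → ∀ i → i ≢ j → e i + c i ≡ b
  complement-off {j} {e} comp i i≢j =
    trans (sym (+-identityʳ _)) (trans (cong (e i + c i +_) (sym (𝟙-no (j ≟ i) (≢-sym i≢j)))) (comp i))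

  -- Off block j, e i ≡ t holds exactly where c i ≡ s.
  mult-complement : ∀ {j e} → Complement b c j e → ∀ t s → t + s ≡ b →
                    mult t e + 𝟙 ⌊ c j ℕ.≟ s ⌋ ≡ mult s c + 𝟙 ⌊ e j ℕ.≟ t ⌋
  mult-complement {j} {e} comp t s t+s≡b = sum-agree-off j agree
    where
    agree : ∀ i → i ≢ j → 𝟙 ⌊ e i ℕ.≟ t ⌋ ≡ 𝟙 ⌊ c i ℕ.≟ s ⌋
    agree i i≢j = cong 𝟙 (⌊⌋-cong (e i ℕ.≟ t) (c i ℕ.≟ s)
      (λ eᵢ≡t → +-cancelˡ-≡ t _ _ (trans (cong (_+ c i) (sym eᵢ≡t)) (trans eᵢ+cᵢ≡b (sym t+s≡b))))
      (λ cᵢ≡s → +-cancelʳ-≡ s _ _ (trans (cong (e i +_) (sym cᵢ≡s)) (trans eᵢ+cᵢ≡b (sym t+s≡b)))))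
      where eᵢ+cᵢ≡b = complement-off comp i i≢j

  -- If e j ≢ c j, the multiplicity of suc (e j) would be both smaller than and at least that of c j.
  same-mult-complement⇒half : ∀ {h j e} → b ≡ suc (2 * h) → Complement b c j e →
                              (∀ t → mult t e ≡ mult t c) → c j ≡ h × e j ≡ h
  same-mult-complement⇒half {h} {j} {e} b-odd comp same with e j ℕ.≟ c j
  ... | yes eⱼ≡cⱼ = cⱼ≡h , trans eⱼ≡cⱼ cⱼ≡h
    where
    cⱼ≡h = odd-half-unique (c j) h (trans (cong (λ u → u + c j + 1) (sym eⱼ≡cⱼ)) (trans (complement-at comp) b-odd))
  ... | no eⱼ≢cⱼ = ⊥-elim (m+1+n≢m M (trans (sym (+-assoc M 1 δ)) (trans (cong (_+ δ) M+1≡mᵥ) mᵥ+δ≡M)))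
    where
    u = e j
    v = c j
    M = mult (suc u) c
    δ = 𝟙 ⌊ v ℕ.≟ suc u ⌋
    1+u+v≡b : suc u + v ≡ b
    1+u+v≡b = trans (+-comm 1 (u + v)) (complement-at comp)
    M+1≡mᵥ : M + 1 ≡ mult v c
    M+1≡mᵥ = begin
      M + 1                                ≡⟨ cong₂ _+_ (sym (same (suc u))) (sym (𝟙-yes (v ℕ.≟ v) refl)) ⟩
      mult (suc u) e + 𝟙 ⌊ v ℕ.≟ v ⌋       ≡⟨ mult-complement comp (suc u) v 1+u+v≡b ⟩
      mult v c + 𝟙 ⌊ u ℕ.≟ suc u ⌋         ≡⟨ cong (mult v c +_) (𝟙-no (u ℕ.≟ suc u) (≢-sym 1+n≢n)) ⟩
      mult v c + 0                         ≡⟨ +-identityʳ (mult v c) ⟩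
      mult v c                             ∎
      where open ≡-Reasoning
    mᵥ+δ≡M : mult v c + δ ≡ M
    mᵥ+δ≡M = begin
      mult v c + δ                         ≡⟨ cong (_+ δ) (sym (same v)) ⟩
      mult v e + δ                         ≡⟨ mult-complement comp v (suc u) (trans (+-comm v (suc u)) 1+u+v≡b) ⟩
      M + 𝟙 ⌊ u ℕ.≟ v ⌋                    ≡⟨ cong (M +_) (𝟙-no (u ℕ.≟ v) eⱼ≢cⱼ) ⟩
      M + 0                                ≡⟨ +-identityʳ M ⟩
      M                                    ∎
      where open ≡-Reasoning

  equal-mult-complements⇒≡ : ∀ {j₁ e₁ j₂ e₂} → Complement b c j₁ e₁ → Complement b c j₂ e₂ →
                             (∀ t → mult t e₁ ≡ mult t e₂) → c j₁ ≡ c j₂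
  equal-mult-complements⇒≡ {j₁} {e₁} {j₂} {e₂} comp₁ comp₂ same with e₂ j₂ ℕ.≟ e₁ j₁
  ... | yes u₂≡u₁ = +-cancelˡ-≡ (e₁ j₁) _ _ (+-cancelʳ-≡ 1 _ _
          (trans (complement-at comp₁) (sym (subst (λ u → u + c j₂ + 1 ≡ b) u₂≡u₁ (complement-at comp₂)))))
  ... | no u₂≢u₁ = ⊥-elim (m+1+n≢m M (trans (sym (+-assoc M 1 δ)) (begin
    M + 1 + δ                  ≡⟨ cong (_+ δ) M+1≡m₁ ⟩
    mult u₁ e₁ + δ             ≡⟨ cong (_+ δ) (same u₁) ⟩
    mult u₁ e₂ + δ             ≡⟨ mult-complement comp₂ u₁ (suc w₁) u₁+1+w₁≡b ⟩
    M + 𝟙 ⌊ e₂ j₂ ℕ.≟ u₁ ⌋     ≡⟨ cong (M +_) (𝟙-no (e₂ j₂ ℕ.≟ u₁) u₂≢u₁) ⟩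
    M + 0                      ≡⟨ +-identityʳ M ⟩
    M                          ∎)))
    where
    open ≡-Reasoning
    u₁ = e₁ j₁
    w₁ = c j₁
    M = mult (suc w₁) c
    δ = 𝟙 ⌊ c j₂ ℕ.≟ suc w₁ ⌋
    u₁+1+w₁≡b : u₁ + suc w₁ ≡ b
    u₁+1+w₁≡b = trans (+-suc u₁ w₁) (trans (+-comm 1 (u₁ + w₁)) (complement-at comp₁))
    M+1≡m₁ : M + 1 ≡ mult u₁ e₁
    M+1≡m₁ = begin
      M + 1                              ≡⟨ cong (M +_) (sym (𝟙-yes (u₁ ℕ.≟ u₁) refl)) ⟩
      M + 𝟙 ⌊ u₁ ℕ.≟ u₁ ⌋                ≡⟨ mult-complement comp₁ u₁ (suc w₁) u₁+1+w₁≡b ⟨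
      mult u₁ e₁ + 𝟙 ⌊ w₁ ℕ.≟ suc w₁ ⌋   ≡⟨ cong (mult u₁ e₁ +_) (𝟙-no (w₁ ℕ.≟ suc w₁) (≢-sym 1+n≢n)) ⟩
      mult u₁ e₁ + 0                     ≡⟨ +-identityʳ (mult u₁ e₁) ⟩
      mult u₁ e₁                         ∎
      where open ≡-Reasoning

  same-mult-complement⇒mult-symmetric : ∀ {h j e} → b ≡ suc (2 * h) → Complement b c j e →
      (∀ t → mult t e ≡ mult t c) →
      ∀ t s → t + s ≡ b → mult t c + 𝟙 ⌊ h ℕ.≟ s ⌋ ≡ mult s c + 𝟙 ⌊ h ℕ.≟ t ⌋
  same-mult-complement⇒mult-symmetric {h} {j} {e} b-odd comp same t s t+s≡b = begin
    mult t c + 𝟙 ⌊ h ℕ.≟ s ⌋    ≡⟨ cong₂ (λ m w → m + 𝟙 ⌊ w ℕ.≟ s ⌋) (sym (same t)) (sym cⱼ≡h) ⟩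
    mult t e + 𝟙 ⌊ c j ℕ.≟ s ⌋  ≡⟨ mult-complement comp t s t+s≡b ⟩
    mult s c + 𝟙 ⌊ e j ℕ.≟ t ⌋  ≡⟨ cong (λ w → mult s c + 𝟙 ⌊ w ℕ.≟ t ⌋) eⱼ≡h ⟩
    mult s c + 𝟙 ⌊ h ℕ.≟ t ⌋    ∎
    where
    open ≡-Reasoning
    cⱼ≡h = proj₁ (same-mult-complement⇒half b-odd comp same)
    eⱼ≡h = proj₂ (same-mult-complement⇒half b-odd comp same)

  off-half-values-agree : ∀ {h} (N : ℕ → ℕ) → b ≡ suc (2 * h) →
      (∀ j → c j < b → ∃ λ e → Complement b c j e ×
                                 ¬ ¬ ((∀ t → mult t e ≡ mult t c) ⊎ (∀ t → mult t e ≡ N t))) →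
      ∀ i₁ i₂ → c i₁ < b → c i₂ < b → c i₁ ≢ h → c i₂ ≢ h → c i₁ ≡ c i₂
  off-half-values-agree {h} N b-odd complements i₁ i₂ c₁<b c₂<b c₁≢h c₂≢h =
    let e₁ , comp₁ , ¬¬N₁ = complement-in-C₁ i₁ c₁<b c₁≢h
        e₂ , comp₂ , ¬¬N₂ = complement-in-C₁ i₂ c₂<b c₂≢h
    -- Membership in C is undecidable, so a neighbour is only known not to avoid both C and C₁;
    -- that suffices because the conclusion is a decidable equation.
    in decidable-stable (c i₁ ℕ.≟ c i₂) λ c₁≢c₂ →
         ¬¬N₁ λ N₁ → ¬¬N₂ λ N₂ →
         c₁≢c₂ (equal-mult-complements⇒≡ comp₁ comp₂ (λ t → trans (N₁ t) (sym (N₂ t))))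
    where
    complement-in-C₁ : ∀ j → c j < b → c j ≢ h → ∃ λ e → Complement b c j e × ¬ ¬ (∀ t → mult t e ≡ N t)
    complement-in-C₁ j cⱼ<b cⱼ≢h =
      let e , comp , in-C-or-C₁ = complements j cⱼ<b in
      e , comp , λ ¬N → in-C-or-C₁ [ (λ same → cⱼ≢h (proj₁ (same-mult-complement⇒half b-odd comp same))) , ¬N ]′

module ProfileShape {a b h q : ℕ} (b-odd : b ≡ suc (2 * h)) (a-odd : a ≡ suc (2 * q)) (h≥1 : 1 ≤ h)
  {c : Fin a → ℕ} (c≤b : ∀ i → c i ≤ b)
  (symmetric : ∀ t s → t + s ≡ b → mult t c + 𝟙 ⌊ h ℕ.≟ s ⌋ ≡ mult s c + 𝟙 ⌊ h ℕ.≟ t ⌋)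
  (agree : ∀ i₁ i₂ → c i₁ < b → c i₂ < b → c i₁ ≢ h → c i₂ ≢ h → c i₁ ≡ c i₂) where

  private
    m : ℕ → ℕ
    m t = mult t c

    h+1+h≡b : h + suc h ≡ b
    h+1+h≡b = trans (+-suc h h) (trans (cong (λ x → suc (h + x)) (sym (+-identityʳ h))) (sym b-odd))

    h<b : h < b
    h<b = subst (h <_) h+1+h≡b (m<m+n h z<s)

    1+h<b : suc h < b
    1+h<b = subst (suc h <_) h+1+h≡b (m<n+m (suc h) h≥1)

    h≢0 : h ≢ 0
    h≢0 h≡0 = <-irrefl (sym h≡0) h≥1

    0<b : 0 < b
    0<b = subst (0 <_) (sym b-odd) z<s

    m[h]≡m[1+h]+1 : m h ≡ m (suc h) + 1
    m[h]≡m[1+h]+1 = begin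
      m h                             ≡⟨ +-identityʳ (m h) ⟨
      m h + 0                         ≡⟨ cong (m h +_) (𝟙-no (h ℕ.≟ suc h) (≢-sym 1+n≢n)) ⟨
      m h + 𝟙 ⌊ h ℕ.≟ suc h ⌋         ≡⟨ symmetric h (suc h) h+1+h≡b ⟩
      m (suc h) + 𝟙 ⌊ h ℕ.≟ h ⌋       ≡⟨ cong (m (suc h) +_) (𝟙-yes (h ℕ.≟ h) refl) ⟩
      m (suc h) + 1                   ∎
      where open ≡-Reasoning

    m[0]≡m[b] : m 0 ≡ m b
    m[0]≡m[b] = begin
      m 0                             ≡⟨ +-identityʳ (m 0) ⟨
      m 0 + 0                         ≡⟨ cong (m 0 +_) (𝟙-no (h ℕ.≟ b) (<⇒≢ h<b)) ⟨
      m 0 + 𝟙 ⌊ h ℕ.≟ b ⌋             ≡⟨ symmetric 0 b refl ⟩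
      m b + 𝟙 ⌊ h ℕ.≟ 0 ⌋             ≡⟨ cong (m b +_) (𝟙-no (h ℕ.≟ 0) h≢0) ⟩
      m b + 0                         ≡⟨ +-identityʳ (m b) ⟩
      m b                             ∎
      where open ≡-Reasoning

    x+1+x≡a⇒x≡q : ∀ x → x + 1 + x ≡ a → x ≡ q
    x+1+x≡a⇒x≡q x x+1+x≡a = odd-half-unique x q
      (trans (trans (+-assoc x x 1) (trans (cong (x +_) (+-comm x 1)) (sym (+-assoc x 1 x)))) (trans x+1+x≡a a-odd))

    ↭-three-values : ∀ {x y z p r s} → x ≢ y → x ≢ z → y ≢ z → (∀ i → c i ≡ x ⊎ c i ≡ y ⊎ c i ≡ z) →
                     m x ≡ p → m y ≡ r → m z ≡ s → tabulate c ↭ replicate p x ++ replicate r y ++ replicate s z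
    ↭-three-values x≢y x≢z y≢z values refl refl refl = tabulate-↭-three-values c x≢y x≢z y≢z values

  -- The value h + 1 occurs; b cannot, as then 0 would occur too, so every value other than h is h + 1.
  balanced : m (suc h) ≢ 0 → tabulate c ↭ replicate (suc q) h ++ replicate q (suc h)
  balanced m[1+h]≢0 = ↭-three-values (≢-sym h≢0) 0≢1+n (≢-sym 1+n≢n) (λ i → inj₂ (values i))
    m[0]≡0
    (trans m[h]≡m[1+h]+1 (trans (cong (_+ 1) m[1+h]≡q) (+-comm q 1)))
    m[1+h]≡q
    where
    i₁ = proj₁ (mult-pos⇒∃ c (n≢0⇒n>0 m[1+h]≢0))
    c₁≡1+h = proj₂ (mult-pos⇒∃ c (n≢0⇒n>0 m[1+h]≢0))
    c₁<b = subst (_< b) (sym c₁≡1+h) 1+h<b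
    c₁≢h = λ c₁≡h → 1+n≢n (trans (sym c₁≡1+h) c₁≡h)
    no-full-block : ∀ i → c i ≢ b
    no-full-block i cᵢ≡b =
      0≢1+n (trans (sym c₀≡0) (trans (agree i₀ i₁ (subst (_< b) (sym c₀≡0) 0<b) c₁<b c₀≢h c₁≢h) c₁≡1+h))
      where
      i₀ = proj₁ (mult-pos⇒∃ c (subst (0 <_) (sym m[0]≡m[b]) (∃⇒mult-pos c i cᵢ≡b)))
      c₀≡0 = proj₂ (mult-pos⇒∃ c (subst (0 <_) (sym m[0]≡m[b]) (∃⇒mult-pos c i cᵢ≡b)))
      c₀≢h = λ c₀≡h → h≢0 (trans (sym c₀≡h) c₀≡0)
    values : ∀ i → c i ≡ h ⊎ c i ≡ suc h
    values i with c i ℕ.≟ h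
    ... | yes cᵢ≡h = inj₁ cᵢ≡h
    ... | no cᵢ≢h = inj₂ (trans (agree i i₁ (≤∧≢⇒< (c≤b i) (no-full-block i)) c₁<b cᵢ≢h c₁≢h) c₁≡1+h)
    m[0]≡0 : m 0 ≡ 0
    m[0]≡0 = mult-absent c (λ i cᵢ≡0 → [ (λ cᵢ≡h → h≢0 (trans (sym cᵢ≡h) cᵢ≡0)) ,
                                         (λ cᵢ≡1+h → 1+n≢0 (trans (sym cᵢ≡1+h) cᵢ≡0)) ]′ (values i))
    m[1+h]≡q : m (suc h) ≡ q
    m[1+h]≡q = x+1+x≡a⇒x≡q (m (suc h)) (begin
      m (suc h) + 1 + m (suc h)       ≡⟨ cong (_+ m (suc h)) m[h]≡m[1+h]+1 ⟨
      m h + m (suc h)                 ≡⟨ cong (λ x → x + m h + m (suc h)) m[0]≡0 ⟨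
      m 0 + m h + m (suc h)           ≡⟨ mult-three-values c (≢-sym h≢0) 0≢1+n (≢-sym 1+n≢n) (λ i → inj₂ (values i)) ⟩
      a                               ∎)
      where open ≡-Reasoning

  -- s = b ∸ w is a value too and differs from h, so agreement gives w ≡ s, making b even.
  no-other-value : m (suc h) ≡ 0 → ∀ i → c i ≢ 0 → c i ≢ h → c i ≢ b → ⊥
  no-other-value m[1+h]≡0 i cᵢ≢0 cᵢ≢h cᵢ≢b = even≢odd w h (begin
    2 * w                           ≡⟨ cong (w +_) (+-identityʳ w) ⟩
    w + w                           ≡⟨ cong (w +_) w≡s ⟩
    w + s                           ≡⟨ w+s≡b ⟩
    b                               ≡⟨ b-odd ⟩
    suc (2 * h)                     ∎)
    where
    open ≡-Reasoning
    w = c i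
    s = b ∸ w
    w+s≡b : w + s ≡ b
    w+s≡b = m+[n∸m]≡n (c≤b i)
    0<m[w] : 0 < m w
    0<m[w] = ∃⇒mult-pos c i refl
    m[w]≤m[s] : m w ≤ m s
    m[w]≤m[s] = ≤-trans (m≤m+n (m w) _) (≤-reflexive (trans (symmetric w s w+s≡b)
      (trans (cong (m s +_) (𝟙-no (h ℕ.≟ w) (λ h≡w → cᵢ≢h (sym h≡w)))) (+-identityʳ (m s)))))
    i′ = proj₁ (mult-pos⇒∃ c (<-≤-trans 0<m[w] m[w]≤m[s]))
    cᵢ′≡s = proj₂ (mult-pos⇒∃ c (<-≤-trans 0<m[w] m[w]≤m[s]))
    s<b : s < b
    s<b = subst (s <_) w+s≡b (m<n+m s (n≢0⇒n>0 cᵢ≢0))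
    s≢h : s ≢ h
    s≢h s≡h = <-irrefl (sym (trans (cong m w≡1+h) m[1+h]≡0)) 0<m[w]
      where
      w≡1+h : w ≡ suc h
      w≡1+h = +-cancelʳ-≡ h w (suc h)
        (trans (cong (w +_) (sym s≡h)) (trans w+s≡b (trans (sym h+1+h≡b) (+-comm h (suc h)))))
    w≡s : w ≡ s
    w≡s = trans (agree i i′ (≤∧≢⇒< (c≤b i) cᵢ≢b) (subst (_< b) (sym cᵢ′≡s) s<b) cᵢ≢h
                             (λ cᵢ′≡h → s≢h (trans (sym cᵢ′≡s) cᵢ′≡h)))
                cᵢ′≡s

  extreme : m (suc h) ≡ 0 → tabulate c ↭ replicate q 0 ++ [ h ] ++ replicate q b
  extreme m[1+h]≡0 = ↭-three-values (≢-sym h≢0) (<⇒≢ 0<b) (<⇒≢ h<b) values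
    m[0]≡q m[h]≡1 (trans (sym m[0]≡m[b]) m[0]≡q)
    where
    m[h]≡1 : m h ≡ 1
    m[h]≡1 = trans m[h]≡m[1+h]+1 (cong (_+ 1) m[1+h]≡0)
    values : ∀ i → c i ≡ 0 ⊎ c i ≡ h ⊎ c i ≡ b
    values i with c i ℕ.≟ 0 | c i ℕ.≟ h | c i ℕ.≟ b
    ... | yes cᵢ≡0 | _ | _ = inj₁ cᵢ≡0
    ... | no _ | yes cᵢ≡h | _ = inj₂ (inj₁ cᵢ≡h)
    ... | no _ | no _ | yes cᵢ≡b = inj₂ (inj₂ cᵢ≡b)
    ... | no cᵢ≢0 | no cᵢ≢h | no cᵢ≢b = ⊥-elim (no-other-value m[1+h]≡0 i cᵢ≢0 cᵢ≢h cᵢ≢b)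
    m[0]≡q : m 0 ≡ q
    m[0]≡q = x+1+x≡a⇒x≡q (m 0) (begin
      m 0 + 1 + m 0                   ≡⟨ cong₂ (λ x y → m 0 + x + y) (sym m[h]≡1) m[0]≡m[b] ⟩
      m 0 + m h + m b                 ≡⟨ mult-three-values c (≢-sym h≢0) (<⇒≢ 0<b) (<⇒≢ h<b) values ⟩
      a                               ∎)
      where open ≡-Reasoning

  profile-shape : tabulate c ↭ replicate (suc q) h ++ replicate q (suc h)
                ⊎ tabulate c ↭ replicate q 0 ++ [ h ] ++ replicate q b
  profile-shape with m (suc h) ℕ.≟ 0
  ... | yes m[1+h]≡0 = inj₂ (extreme m[1+h]≡0)
  ... | no m[1+h]≢0 = inj₁ (balanced m[1+h]≢0)

-- Subsets of a finite set

∣p∣≡∑ : ∀ {n} (p : Subset n) → ∣ p ∣ ≡ sum (λ x → 𝟙 (lookup p x))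
∣p∣≡∑ Vec.[] = refl
∣p∣≡∑ (true Vec.∷ p) = cong suc (∣p∣≡∑ p)
∣p∣≡∑ (false Vec.∷ p) = ∣p∣≡∑ p

∣p∩q∣≡∑ : ∀ {n} (p q : Subset n) → ∣ p ∩ q ∣ ≡ sum (λ x → 𝟙 (lookup p x ∧ lookup q x))
∣p∩q∣≡∑ p q = trans (∣p∣≡∑ (p ∩ q)) (sum-cong-≗ (λ x → cong 𝟙 (lookup-zipWith _∧_ x p q)))

sum-𝟙-≟ : ∀ {n} (y : Fin n) (u : Fin n → Bool) → sum (λ x → 𝟙 (⌊ x ≟ y ⌋ ∧ u x)) ≡ 𝟙 (u y)
sum-𝟙-≟ y u = trans (sum-concentrated y off) (at (y ≟ y))
  where
  off : ∀ x → x ≢ y → 𝟙 (⌊ x ≟ y ⌋ ∧ u x) ≡ 0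
  off x x≢y with x ≟ y
  ... | yes x≡y = ⊥-elim (x≢y x≡y)
  ... | no _ = refl
  at : (d : Dec (y ≡ y)) → 𝟙 (⌊ d ⌋ ∧ u y) ≡ 𝟙 (u y)
  at (yes _) = refl
  at (no y≢y) = ⊥-elim (y≢y refl)

Partition : ∀ {n} → Subset n → Subset n → Fin n → Set
Partition p q y = ∀ x → 𝟙 (lookup p x) + 𝟙 (lookup q x) + 𝟙 ⌊ x ≟ y ⌋ ≡ 1

partition-∩ : ∀ {n} (p q : Subset n) {y} → Partition p q y →
              ∀ W → ∣ p ∩ W ∣ + ∣ q ∩ W ∣ + 𝟙 (lookup W y) ≡ ∣ W ∣
partition-∩ p q {y} part W = begin
  ∣ p ∩ W ∣ + ∣ q ∩ W ∣ + 𝟙 (lookup W y)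
    ≡⟨ cong₂ _+_ (cong₂ _+_ (∣p∩q∣≡∑ p W) (∣p∩q∣≡∑ q W)) (sym (sum-𝟙-≟ y (lookup W))) ⟩
  sum [p] + sum [q] + sum [y]             ≡⟨ cong (_+ sum [y]) (∑-distrib-+ [p] [q]) ⟨
  sum (λ x → [p] x + [q] x) + sum [y]     ≡⟨ ∑-distrib-+ (λ x → [p] x + [q] x) [y] ⟨
  sum (λ x → [p] x + [q] x + [y] x)
    ≡⟨ sum-cong-≗ (λ x → restrict (lookup p x) (lookup q x) ⌊ x ≟ y ⌋ (lookup W x) (part x)) ⟩
  sum (λ x → 𝟙 (lookup W x))              ≡⟨ ∣p∣≡∑ W ⟨
  ∣ W ∣                                   ∎
  where
  open ≡-Reasoning
  [p] [q] [y] : _ → ℕ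
  [p] x = 𝟙 (lookup p x ∧ lookup W x)
  [q] x = 𝟙 (lookup q x ∧ lookup W x)
  [y] x = 𝟙 (⌊ x ≟ y ⌋ ∧ lookup W x)
  restrict : ∀ u v w B → 𝟙 u + 𝟙 v + 𝟙 w ≡ 1 → 𝟙 (u ∧ B) + 𝟙 (v ∧ B) + 𝟙 (w ∧ B) ≡ 𝟙 B
  restrict u v w true one rewrite ∧-identityʳ u | ∧-identityʳ v | ∧-identityʳ w = one
  restrict u v w false _ rewrite ∧-zeroʳ u | ∧-zeroʳ v | ∧-zeroʳ w = refl

partition-card : ∀ {n} (p q : Subset n) {y} → Partition p q y → ∣ p ∣ + ∣ q ∣ + 1 ≡ n
partition-card {n} p q {y} part = begin
  ∣ p ∣ + ∣ q ∣ + 1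
    ≡⟨ cong₂ (λ p′ q′ → ∣ p′ ∣ + ∣ q′ ∣ + 1) (∩-identityʳ p) (∩-identityʳ q) ⟨
  ∣ p ∩ ⊤ ∣ + ∣ q ∩ ⊤ ∣ + 1
    ≡⟨ cong (λ u → ∣ p ∩ ⊤ ∣ + ∣ q ∩ ⊤ ∣ + 𝟙 u) (lookup-replicate y true) ⟨
  ∣ p ∩ ⊤ ∣ + ∣ q ∩ ⊤ ∣ + 𝟙 (lookup ⊤ y)       ≡⟨ partition-∩ p q part ⊤ ⟩
  ∣ ⊤ {n} ∣                                    ≡⟨ ∣⊤∣≡n n ⟩
  n                                            ∎
  where open ≡-Reasoning

disjoint⇒partition : ∀ {n} {p q : Subset n} → p ∩ q ≡ ∅ → suc (∣ p ∣ + ∣ q ∣) ≡ n → ∃ λ y → Partition p q y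
disjoint⇒partition {n} {p} {q} p∩q≡∅ size = y , pointwise-≤-sum-≡⇒≡ at-most-one total
  where
  open ≡-Reasoning
  [p+q] : Fin n → ℕ
  [p+q] x = 𝟙 (lookup p x) + 𝟙 (lookup q x)
  ∑[p+q]≡∣p∣+∣q∣ : sum [p+q] ≡ ∣ p ∣ + ∣ q ∣
  ∑[p+q]≡∣p∣+∣q∣ =
    trans (∑-distrib-+ (λ x → 𝟙 (lookup p x)) (λ x → 𝟙 (lookup q x))) (sym (cong₂ _+_ (∣p∣≡∑ p) (∣p∣≡∑ q)))
  uncovered = sum-<⇒∃< {f = [p+q]} {g = λ _ → 1}
    (subst₂ _<_ (sym ∑[p+q]≡∣p∣+∣q∣) (sym (sum-ones n)) (≤-reflexive size))
  y = proj₁ uncovered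
  both-false : ∀ u v → 𝟙 u + 𝟙 v < 1 → u ≡ false × v ≡ false
  both-false false false _ = refl , refl
  both-false true _ (s≤s ())
  both-false false true (s≤s ())
  y∉p = proj₁ (both-false (lookup p y) (lookup q y) (proj₂ uncovered))
  y∉q = proj₂ (both-false (lookup p y) (lookup q y) (proj₂ uncovered))
  at-most-one : ∀ x → [p+q] x + 𝟙 ⌊ x ≟ y ⌋ ≤ 1
  at-most-one x with x ≟ y
  ... | yes refl rewrite y∉p | y∉q = ≤-refl
  ... | no _ = ≤-trans (≤-reflexive (+-identityʳ ([p+q] x))) (disjoint (lookup p x) (lookup q x) (p∩q∌ x))
    where
    p∩q∌ : ∀ x → lookup p x ∧ lookup q x ≡ false
    p∩q∌ x = trans (sym (lookup-zipWith _∧_ x p q)) (trans (cong (λ r → lookup r x) p∩q≡∅) (lookup-replicate x false))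
    disjoint : ∀ u v → u ∧ v ≡ false → 𝟙 u + 𝟙 v ≤ 1
    disjoint true false _ = ≤-refl
    disjoint false v _ = 𝟙≤1 v
  total : sum (λ x → [p+q] x + 𝟙 ⌊ x ≟ y ⌋) ≡ sum {n} (λ _ → 1)
  total = begin
    sum (λ x → [p+q] x + 𝟙 ⌊ x ≟ y ⌋)   ≡⟨ ∑-distrib-+ [p+q] (λ x → 𝟙 ⌊ x ≟ y ⌋) ⟩
    sum [p+q] + sum (λ x → 𝟙 ⌊ x ≟ y ⌋) ≡⟨ cong₂ _+_ ∑[p+q]≡∣p∣+∣q∣ ∑[y]≡1 ⟩
    ∣ p ∣ + ∣ q ∣ + 1                   ≡⟨ +-comm _ 1 ⟩
    suc (∣ p ∣ + ∣ q ∣)                 ≡⟨ size ⟩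
    n                                   ≡⟨ sum-ones n ⟨
    sum {n} (λ _ → 1)                   ∎
    where
    ∑[y]≡1 : sum (λ x → 𝟙 ⌊ x ≟ y ⌋) ≡ 1
    ∑[y]≡1 = trans (sum-cong-≗ {n} (λ x → cong 𝟙 (sym (∧-identityʳ ⌊ x ≟ y ⌋)))) (sum-𝟙-≟ y (λ _ → true))

complement : ∀ {n} → Subset n → Fin n → Subset n
complement p y = Vec.tabulate (λ x → not (lookup p x) ∧ not ⌊ x ≟ y ⌋)

lookup-complement : ∀ {n} (p : Subset n) y x → lookup (complement p y) x ≡ not (lookup p x) ∧ not ⌊ x ≟ y ⌋
lookup-complement p y = lookup∘tabulate (λ x → not (lookup p x) ∧ not ⌊ x ≟ y ⌋)

complement-partition : ∀ {n} (p : Subset n) {y} → lookup p y ≡ false → Partition (complement p y) p y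
complement-partition p {y} y∉p x rewrite lookup-complement p y x with x ≟ y
... | yes refl rewrite y∉p = refl
... | no _ with lookup p x
...   | true = refl
...   | false = refl

complement-disjoint : ∀ {n} (p : Subset n) y → complement p y ∩ p ≡ ∅
complement-disjoint p y = trans (sym (tabulate∘lookup (complement p y ∩ p)))
  (trans (tabulate-cong outside) (tabulate∘lookup ∅))
  where
  outside : ∀ x → lookup (complement p y ∩ p) x ≡ lookup ∅ x
  outside x rewrite lookup-zipWith _∧_ x (complement p y) p | lookup-complement p y x | lookup-replicate x false
    with lookup p x
  ... | true = refl
  ... | false = ∧-zeroʳ _

partition-vertex : ∀ {k} (γ α : Sub k) {y} → Partition γ α y → IsVertex k α → IsVertex k γ
partition-vertex {k} γ α part ∣α∣≡k = +-cancelʳ-≡ k ∣ γ ∣ k (suc-injective (begin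
  suc (∣ γ ∣ + k)      ≡⟨ +-comm 1 (∣ γ ∣ + k) ⟩
  ∣ γ ∣ + k + 1        ≡⟨ cong (λ m → ∣ γ ∣ + m + 1) ∣α∣≡k ⟨
  ∣ γ ∣ + ∣ α ∣ + 1    ≡⟨ partition-card γ α part ⟩
  suc (2 * k)          ≡⟨ cong (λ m → suc (k + m)) (+-identityʳ k) ⟩
  suc (k + k)          ∎))
  where open ≡-Reasoning

∣p∩W∣<∣W∣⇒∃ : ∀ {n} (p W : Subset n) → ∣ p ∩ W ∣ < ∣ W ∣ →
              ∃ λ y → lookup p y ≡ false × lookup W y ≡ true
∣p∩W∣<∣W∣⇒∃ p W ∣p∩W∣<∣W∣ =
  let y , lt = sum-<⇒∃< (subst₂ _<_ (∣p∩q∣≡∑ p W) (∣p∣≡∑ W) ∣p∩W∣<∣W∣)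
  in y , missing (lookup p y) (lookup W y) lt
  where
  missing : ∀ u v → 𝟙 (u ∧ v) < 𝟙 v → u ≡ false × v ≡ true
  missing false true _ = refl , refl
  missing true true (s≤s ())

module Blocks (k a : ℕ) (blk : Ω k → Fin a) where

  profile : Sub k → Fin a → ℕ
  profile X i = ∣ X ∩ Block k a blk i ∣

  ι≡tabulate-profile : ∀ X → ι k a blk X ≡ tabulate (profile X)
  ι≡tabulate-profile X = map-tabulate (λ i → i) (profile X)

  lookup-Block : ∀ i x → lookup (Block k a blk i) x ≡ ⌊ blk x ≟ i ⌋
  lookup-Block i = lookup∘tabulate (λ x → ⌊ blk x ≟ i ⌋)

  module _ {b} (sizes : ∀ i → ∣ Block k a blk i ∣ ≡ b) where

    profile≤b : ∀ X i → profile X i ≤ b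
    profile≤b X i = subst (profile X i ≤_) (sizes i) (∣p∩q∣≤∣q∣ X (Block k a blk i))

    partition⇒complement : ∀ γ α {y} → Partition γ α y → Complement b (profile α) (blk y) (profile γ)
    partition⇒complement γ α {y} part i = begin
      profile γ i + profile α i + 𝟙 ⌊ blk y ≟ i ⌋
        ≡⟨ cong (λ u → profile γ i + profile α i + 𝟙 u) (lookup-Block i y) ⟨
      profile γ i + profile α i + 𝟙 (lookup (Block k a blk i) y)
        ≡⟨ partition-∩ γ α part (Block k a blk i) ⟩
      ∣ Block k a blk i ∣
        ≡⟨ sizes i ⟩
      b ∎
      where open ≡-Reasoning

    room-in-block : ∀ α j → profile α j < b → ∃ λ y → lookup α y ≡ false × blk y ≡ j
    room-in-block α j αⱼ<b =
      let y , y∉α , y∈Bⱼ = ∣p∩W∣<∣W∣⇒∃ α (Block k a blk j) (subst (profile α j <_) (sym (sizes j)) αⱼ<b)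
      in y , y∉α , 𝟙-pos (blk y ≟ j) (subst (λ u → 0 < 𝟙 u) (trans (sym y∈Bⱼ) (lookup-Block j y)) z<s)

    block-representative : 0 < b → ∀ i → ∃ λ x → blk x ≡ i
    block-representative 0<b i =
      let x , 0<𝟙 = sum-<⇒∃< {f = λ _ → 0} {g = λ x → 𝟙 (lookup (Block k a blk i) x)}
                      (subst₂ _<_ (sym (sum-replicate-zero (suc (2 * k))))
                                  (trans (sym (sizes i)) (∣p∣≡∑ (Block k a blk i))) 0<b)
      in x , 𝟙-pos (blk x ≟ i) (subst (λ u → 0 < 𝟙 u) (lookup-Block i x) 0<𝟙)

-- Automorphisms permute the blocks

lookup-act : ∀ k (g : Sym k) α y → lookup (act k g α) y ≡ lookup α (g ⟨$⟩ˡ y)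
lookup-act k g α = lookup∘tabulate (λ y → lookup α (g ⟨$⟩ˡ y))

act-flip : ∀ k (g : Sym k) β → act k g (act k (flip g) β) ≡ β
act-flip k g β = trans (tabulate-cong (λ y → trans (lookup-act k (flip g) β (g ⟨$⟩ˡ y)) (cong (lookup β) (inverseʳ g))))
                         (tabulate∘lookup β)

InAut-flip : ∀ k (C : Code k) (g : Sym k) → InAut k C g → InAut k C (flip g)
InAut-flip k C g g∈Aut β = mk⇔
  (λ β∈C → Equivalence.from (g∈Aut (act k (flip g) β)) (subst C (sym (act-flip k g β)) β∈C))
  (λ g⁻¹β∈C → subst C (act-flip k g β) (Equivalence.to (g∈Aut (act k (flip g) β)) g⁻¹β∈C))

module BlockPermutation {k a : ℕ} {blk : Ω k → Fin a} (rep : ∀ i → ∃ λ x → blk x ≡ i) (g : Sym k)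
  (g-blocks : ∀ x y → blk x ≡ blk y → blk (g ⟨$⟩ʳ x) ≡ blk (g ⟨$⟩ʳ y))
  (g⁻¹-blocks : ∀ x y → blk x ≡ blk y → blk (g ⟨$⟩ˡ x) ≡ blk (g ⟨$⟩ˡ y)) where

  open Blocks k a blk

  private
    x̂ : Fin a → Ω k
    x̂ i = proj₁ (rep i)
    blk-x̂ : ∀ i → blk (x̂ i) ≡ i
    blk-x̂ i = proj₂ (rep i)

  π : Permutation a a
  π = permutation (λ i → blk (g ⟨$⟩ˡ x̂ i)) (λ i → blk (g ⟨$⟩ʳ x̂ i))
    (λ i → trans (g⁻¹-blocks _ _ (blk-x̂ _)) (trans (cong blk (inverseˡ g)) (blk-x̂ i)))
    (λ i → trans (g-blocks _ _ (blk-x̂ _)) (trans (cong blk (inverseʳ g)) (blk-x̂ i)))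

  blk-g⁻¹ : ∀ y i → blk y ≡ i → blk (g ⟨$⟩ˡ y) ≡ π ⟨$⟩ʳ i
  blk-g⁻¹ y i blk-y≡i = g⁻¹-blocks y (x̂ i) (trans blk-y≡i (sym (blk-x̂ i)))

  blk-g⁻¹⁻ : ∀ y i → blk (g ⟨$⟩ˡ y) ≡ π ⟨$⟩ʳ i → blk y ≡ i
  blk-g⁻¹⁻ y i eq = trans (cong blk (sym (inverseʳ g))) (trans (g-blocks (g ⟨$⟩ˡ y) (g ⟨$⟩ˡ x̂ i) eq)
                      (trans (cong blk (inverseʳ g)) (blk-x̂ i)))

  profile-act : ∀ α i → profile (act k g α) i ≡ profile α (π ⟨$⟩ʳ i)
  profile-act α i = begin
    profile (act k g α) i                               ≡⟨ ∣p∩q∣≡∑ (act k g α) (Block k a blk i) ⟩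
    sum (λ y → 𝟙 (lookup (act k g α) y ∧ lookup (Block k a blk i) y)) ≡⟨ sum-cong-≗ moved ⟩
    sum (λ y → H (g ⟨$⟩ˡ y))                                ≡⟨ sum-permute H (flip g) ⟨
    sum H                                                   ≡⟨ ∣p∩q∣≡∑ α (Block k a blk (π ⟨$⟩ʳ i)) ⟨
    profile α (π ⟨$⟩ʳ i)                                ∎
    where
    open ≡-Reasoning
    H : Ω k → ℕ
    H z = 𝟙 (lookup α z ∧ lookup (Block k a blk (π ⟨$⟩ʳ i)) z)
    moved : ∀ y → 𝟙 (lookup (act k g α) y ∧ lookup (Block k a blk i) y) ≡ H (g ⟨$⟩ˡ y)
    moved y = cong 𝟙 (cong₂ _∧_ (lookup-act k g α y) (begin
      lookup (Block k a blk i) y                  ≡⟨ lookup-Block i y ⟩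
      ⌊ blk y ≟ i ⌋
        ≡⟨ ⌊⌋-cong (blk y ≟ i) (blk (g ⟨$⟩ˡ y) ≟ π ⟨$⟩ʳ i) (blk-g⁻¹ y i) (blk-g⁻¹⁻ y i) ⟩
      ⌊ blk (g ⟨$⟩ˡ y) ≟ π ⟨$⟩ʳ i ⌋               ≡⟨ lookup-Block (π ⟨$⟩ʳ i) (g ⟨$⟩ˡ y) ⟨
      lookup (Block k a blk (π ⟨$⟩ʳ i)) (g ⟨$⟩ˡ y) ∎))

  mult-profile-act : ∀ α t → mult t (profile (act k g α)) ≡ mult t (profile α)
  mult-profile-act α t = trans (sum-cong-≗ (λ i → cong (λ v → 𝟙 ⌊ v ℕ.≟ t ⌋) (profile-act α i)))
                               (sym (sum-permute (λ i → 𝟙 ⌊ profile α i ℕ.≟ t ⌋) π))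

even-or-odd : ∀ n → (∃ λ q → n ≡ 2 * q) ⊎ (∃ λ q → n ≡ suc (2 * q))
even-or-odd zero = inj₁ (0 , refl)
even-or-odd (suc n) with even-or-odd n
... | inj₁ (q , n≡2q) = inj₂ (q , cong suc n≡2q)
... | inj₂ (q , n≡1+2q) = inj₁ (suc q , trans (cong suc n≡1+2q) (sym (*-suc 2 q)))

odd-factorˡ : ∀ {a b m} → a * b ≡ suc (2 * m) → ∃ λ q → a ≡ suc (2 * q)
odd-factorˡ {a} {b} {m} ab≡odd with even-or-odd a
... | inj₂ a-odd = a-odd
... | inj₁ (q , refl) = ⊥-elim (even≢odd (q * b) m (trans (sym (*-assoc 2 q b)) ab≡odd))

odd≥2⇒half≥1 : ∀ {b h} → b ≡ suc (2 * h) → 2 ≤ b → 1 ≤ h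
odd≥2⇒half≥1 {h = zero} refl (s≤s ())
odd≥2⇒half≥1 {h = suc h} _ _ = s≤s z≤n

half-double : ∀ q → 2 * q / 2 ≡ q
half-double q = trans (cong (_/ 2) (*-comm 2 q)) (m*n/n≡m q 2)

half-odd+1 : ∀ q → (suc (2 * q) + 1) / 2 ≡ suc q
half-odd+1 q = trans (cong (_/ 2) (trans (+-comm _ 1) (sym (*-suc 2 q)))) (half-double (suc q))

multiset₁-odd : ∀ {a b} q h → a ≡ suc (2 * q) → b ≡ suc (2 * h) →
                multiset₁ a b ≡ replicate (suc q) h ++ replicate q (suc h)
multiset₁-odd q h refl refl =
  cong₂ _++_ (cong₂ replicate (half-odd+1 q) (half-double h)) (cong₂ replicate (half-double q) (half-odd+1 h))

multiset₂-odd : ∀ {a b} q h → a ≡ suc (2 * q) → b ≡ suc (2 * h) →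
                multiset₂ a b ≡ replicate q 0 ++ [ h ] ++ replicate q b
multiset₂-odd q h refl refl =
  cong₂ (λ r x → replicate r 0 ++ [ x ] ++ replicate r (suc (2 * h))) (half-double q) (half-double h)

module NeighbourTransitiveCode {k : ℕ} {C : Code k} (code : IsCodeIn k C) (nt : NeighbourTransitive k C)
  {a b : ℕ} {blk : Ω k → Fin a} (blocks : IsBlockSystem k C a b blk) (0<b : 0 < b) where

  open Blocks k a blk

  private
    sizes = proj₁ blocks
    γ₀ = proj₁ (proj₁ nt)

  mult-profile-transport : ∀ α β → (∃ λ g → InAut k C g × act k g α ≡ β) →
                           ∀ t → mult t (profile β) ≡ mult t (profile α)
  mult-profile-transport α β (g , g∈Aut , refl) = BlockPermutation.mult-profile-act {k} {a} {blk}
    (block-representative sizes 0<b) g (proj₂ blocks g g∈Aut) (proj₂ blocks (flip g) (InAut-flip k C g g∈Aut)) α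

  codeword-mult : ∀ {α β} → C α → C β → ∀ t → mult t (profile β) ≡ mult t (profile α)
  codeword-mult {α} {β} α∈C β∈C = mult-profile-transport α β (proj₁ (proj₂ nt) α β α∈C β∈C)

  C₁-mult : ℕ → ℕ
  C₁-mult t = mult t (profile γ₀)

  neighbour-mult : ∀ {γ} → InC₁ k C γ → ∀ t → mult t (profile γ) ≡ C₁-mult t
  neighbour-mult {γ} γ∈C₁ = mult-profile-transport γ₀ γ (proj₂ (proj₂ nt) γ₀ γ (proj₂ (proj₁ nt)) γ∈C₁)

  codeword-ι-↭ : ∀ {α L} → C α → tabulate (profile α) ↭ L → ∀ γ → C γ → ι k a blk γ ↭ L
  codeword-ι-↭ {α} α∈C α↭L γ γ∈C = subst (_↭ _) (sym (ι≡tabulate-profile γ)) (↭-trans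
    (count-≗⇒↭ _ _ (λ t → trans (count-tabulate t (profile γ))
                     (trans (codeword-mult α∈C γ∈C t) (sym (count-tabulate t (profile α))))))
    α↭L)

  codeword-complements : ∀ {α} → C α → ∀ j → profile α j < b →
    ∃ λ e → Complement b (profile α) j e ×
            ¬ ¬ ((∀ t → mult t e ≡ mult t (profile α)) ⊎ (∀ t → mult t e ≡ C₁-mult t))
  codeword-complements {α} α∈C j αⱼ<b with room-in-block sizes α j αⱼ<b
  ... | y , y∉α , refl = profile γ , partition⇒complement sizes γ α part , λ neither →
    neither (inj₂ (neighbour-mult (γ-vertex , (λ γ∈C → neither (inj₁ (codeword-mult α∈C γ∈C))) ,
                                   α , α∈C , complement-disjoint α y)))
    where
    γ = complement α y
    part = complement-partition α y∉α
    γ-vertex = partition-vertex γ α part (code α α∈C)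

  adjacent-codeword-complement : ∀ {α β} → C α → C β → Adjacent k α β →
    ∃ λ j → Complement b (profile α) j (profile β) × (∀ t → mult t (profile β) ≡ mult t (profile α))
  adjacent-codeword-complement {α} {β} α∈C β∈C α∩β≡∅ =
    let y , part = disjoint⇒partition (trans (∩-comm β α) α∩β≡∅)
                     (cong suc (trans (cong₂ _+_ (code β β∈C) (code α α∈C)) (cong (k +_) (sym (+-identityʳ k)))))
    in blk y , partition⇒complement sizes β α part , codeword-mult α∈C β∈C

  adjacent-codeword-profile-shape : ∀ {α β} → C α → C β → Adjacent k α β →
    ∀ q h → a ≡ suc (2 * q) → b ≡ suc (2 * h) → 1 ≤ h →
    tabulate (profile α) ↭ replicate (suc q) h ++ replicate q (suc h)
    ⊎ tabulate (profile α) ↭ replicate q 0 ++ [ h ] ++ replicate q b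
  adjacent-codeword-profile-shape {α} α∈C β∈C α∩β≡∅ q h a-odd b-odd h≥1 =
    let j , comp , same = adjacent-codeword-complement α∈C β∈C α∩β≡∅
    in ProfileShape.profile-shape {h = h} {q} b-odd a-odd h≥1 (profile≤b sizes α)
         (same-mult-complement⇒mult-symmetric {h = h} b-odd comp same)
         (off-half-values-agree {h = h} C₁-mult b-odd (codeword-complements α∈C))

lemma5p4 : (k : ℕ) → k ≥ 2 → (C : Code k) → IsCodeIn k C
    → NonTrivial k C → NeighbourTransitive k C → MinDistOne k C
    → TransitiveOnΩ k C
    → (a b : ℕ) → a ≥ 2 → b ≥ 2 → a * b ≡ suc (2 * k)
    → (blk : Ω k → Fin a) → IsBlockSystem k C a b blk
    → (∀ α → C α → ι k a blk α ↭ multiset₁ a b)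
      ⊎ (∀ α → C α → ι k a blk α ↭ multiset₂ a b)
lemma5p4 k _ C code _ nt (α , β , α∈C , β∈C , α∩β≡∅) _ a b _ b≥2 ab≡1+2k blk blocks =
  let q , a-odd = odd-factorˡ {m = k} ab≡1+2k
      h , b-odd = odd-factorˡ {m = k} (trans (*-comm b a) ab≡1+2k)
  in Data.Sum.map
       (λ shape γ γ∈C → subst (ι k a blk γ ↭_) (sym (multiset₁-odd q h a-odd b-odd))
                                (codeword-ι-↭ α∈C shape γ γ∈C))
       (λ shape γ γ∈C → subst (ι k a blk γ ↭_) (sym (multiset₂-odd q h a-odd b-odd))
                                (codeword-ι-↭ α∈C shape γ γ∈C))
       (adjacent-codeword-profile-shape α∈C β∈C α∩β≡∅ q h a-odd b-odd (odd≥2⇒half≥1 b-odd b≥2))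
  where open NeighbourTransitiveCode code nt blocks (≤-trans z<s b≥2)
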